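{- Let $q$ be a power of an odd prime. If $a,b,c\in\mathbb{F}_q$, $ab\ne0$, and $a^2+b^2=c^2$, then $\left(\frac{c+a}{q}\right)=\left(\frac{2}{q}\right)\left(\frac{c+b}{q}\right)\ne0$. Also $\left(\frac{c+a}{q}\right)=\left(\frac{c-a}{q}\right)$ and $\left(\frac{c+b}{q}\right)=\left(\frac{c-b}{q}\right)$.
   Context: $\mathbb{F}_q$ is the field with $q$ elements. For $x\in\mathbb{F}_q$, $\left(\frac{x}{q}\right)$ is the Legendre symbol ($1$ on nonzero squares, $-1$ on nonsquares, $0$ at $0$). -}

module Defs where

open import Level using (0ℓ)
open import Algebra.Bundles using (CommutativeRing)
open import Data.Nat using (ℕ)
open import Data.Fin using (Fin)
open import Data.Fin.Properties using (any?)
open import Data.Integer using (ℤ; 0ℤ; 1ℤ; -1ℤ)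
open import Data.Product using (∃; _,_)
open import Relation.Nullary using (¬_; Dec; yes; no)
open import Relation.Binary using (Decidable)
open import Relation.Binary.PropositionalEquality using (_≡_)

record FiniteField (q : ℕ) : Set₁ where
  field
    commRing : CommutativeRing 0ℓ 0ℓ
  open CommutativeRing commRing public
  field
    _≟_       : Decidable _≈_
    0≉1       : ¬ (0# ≈ 1#)
    inverse   : ∀ x → ¬ (x ≈ 0#) → ∃ λ y → x * y ≈ 1#
    enum      : Fin q → Carrier
    enum-surj : ∀ x → ∃ λ i → enum i ≈ x
    enum-inj  : ∀ i j → enum i ≈ enum j → i ≡ j

  2# : Carrier
  2# = 1# + 1#

  IsSquare : Carrier → Set
  IsSquare x = ∃ λ y → y * y ≈ x

  isSquare? : ∀ x → Dec (IsSquare x)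
  isSquare? x with any? (λ i → (enum i * enum i) ≟ x)
  ... | yes (i , e) = yes (enum i , e)
  ... | no ¬e = no λ { (y , e) → let (i , ei) = enum-surj y in
                         ¬e (i , trans (*-cong ei ei) e) }

  legendre : Carrier → ℤ
  legendre x with x ≟ 0#
  ... | yes _ = 0ℤ
  ... | no _ with isSquare? x
  ... | yes _ = 1ℤ
  ... | no _ = -1ℤ

-- The relations (c + a)(c − a) = b², (c + b)(c − b) = a² and
-- (c + a) · 2(c + b) = (c + a + b)² show that in each stated pair the two
-- elements have a nonzero square as product, hence equal Legendre symbols.
-- What remains, (2(c + b)/q) = (2/q)((c + b)/q), is multiplicativity, whose
-- only nontrivial case — a product of two nonsquares is a square — is a
-- counting argument: since q is odd, x ↦ −x pairs off the nonzero elements and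
-- squaring is injective on one element of each pair, so at least half of the
-- nonzero elements are squares; whereas if x, y and xy were nonsquares,
-- multiplication by x would inject the squares into the nonsquares missing y.
module Submission where

open import Defs
open import Level using (Level; 0ℓ)
open import Function using (_∘_)
open import Algebra.Bundles using (CommutativeRing; CancellativeCommutativeSemiring)
open import Algebra.Definitions using (AlmostLeftCancellative)
import Algebra.Properties.CancellativeCommutativeSemiring as CancellativeCommutativeSemiringProperties
import Algebra.Solver.Ring.NaturalCoefficients.Default as NaturalCoefficients
open import Data.Nat using (ℕ; zero; suc; _^_; _≤_; _<_; z≤n; s≤s) renaming (_+_ to _+ℕ_; _*_ to _*ℕ_)
import Data.Nat.Properties as ℕ
open import Data.Nat.Divisibility using (_∤_; divides; ∣1⇒≡1)
open import Data.Nat.Primality using (Prime; prime[2]; euclidsLemma; prime⇒irreducible)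
open import Data.Integer using (0ℤ; 1ℤ; -1ℤ) renaming (_*_ to _*ℤ_)
open import Data.Fin using (Fin)
import Data.Fin as Fin
import Data.Fin.Properties as Fin
open import Data.List using (List; []; _∷_; length; filter; map; allFin)
open import Data.List.Properties using (filter-notAll; filter-all; length-map; length-tabulate)
open import Data.List.Membership.Propositional using (_∈_)
open import Data.List.Membership.Propositional.Properties using (∈-filter⁺; ∈-filter⁻; ∈-map⁻; ∈-allFin)
open import Data.List.Relation.Binary.Subset.Propositional using (_⊆_)
open import Data.List.Relation.Unary.Any as Any using (here; there)
open import Data.List.Relation.Unary.All as All using (All; []; _∷_)
import Data.List.Relation.Unary.All.Properties as All
open import Data.List.Relation.Unary.AllPairs using ([]; _∷_)
open import Data.List.Relation.Unary.Unique.Propositional using (Unique)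
import Data.List.Relation.Unary.Unique.Propositional.Properties as Unique
open import Data.Product using (∃; _×_; _,_; proj₁; proj₂)
open import Data.Sum as Sum using (_⊎_; inj₁; inj₂)
open import Data.Unit using (tt)
open import Data.Empty using (⊥-elim)
open import Relation.Nullary using (¬_; Dec; yes; no; ¬?; contradiction)
open import Relation.Nullary.Decidable using (decidable-stable)
open import Relation.Unary using (Pred; Decidable; _∩_; ∁)
open import Relation.Unary.Properties using (U?; _∩?_; ∁?)
open import Relation.Binary using (Setoid)
open import Relation.Binary.Definitions using (DecidableEquality; _Respects_; tri<; tri≈; tri>)
open import Relation.Binary.PropositionalEquality as ≡ using (_≡_; _≢_)

private
  variable
    a p r : Level
    A B : Set a

module _ (_≟_ : DecidableEquality A) where

  Unique∧⊆⇒length≤ : ∀ {xs ys : List A} → Unique xs → xs ⊆ ys → length xs ≤ length ys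
  Unique∧⊆⇒length≤ {[]} _ _ = z≤n
  Unique∧⊆⇒length≤ {x ∷ xs} {ys} (x∉xs ∷ xs!) x∷xs⊆ys = begin
    suc (length xs)              ≤⟨ s≤s (Unique∧⊆⇒length≤ xs! xs⊆ys-x) ⟩
    suc (length (filter ≢x? ys)) ≤⟨ filter-notAll ≢x? ys (Any.map (λ x≡y x≢y → x≢y (≡.sym x≡y)) (x∷xs⊆ys (here ≡.refl))) ⟩
    length ys                    ∎
    where
    open ℕ.≤-Reasoning
    ≢x? : Decidable (_≢ x)
    ≢x? y = ¬? (y ≟ x)
    xs⊆ys-x : xs ⊆ filter ≢x? ys
    xs⊆ys-x y∈xs = ∈-filter⁺ ≢x? (x∷xs⊆ys (there y∈xs)) (λ y≡x → All.lookup x∉xs y∈xs (≡.sym y≡x))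

map⁺-injectiveOn : ∀ {P : Pred A p} {f : A → B} {xs} →
                   (∀ {x y} → P x → P y → f x ≡ f y → x ≡ y) →
                   All P xs → Unique xs → Unique (map f xs)
map⁺-injectiveOn inj [] [] = []
map⁺-injectiveOn {P = P} {f = f} {xs = x ∷ xs} inj (px ∷ pxs) (x∉xs ∷ xs!) =
  fx∉fxs pxs x∉xs ∷ map⁺-injectiveOn inj pxs xs!
  where
  fx∉fxs : ∀ {ys} → All P ys → All (x ≢_) ys → All (f x ≢_) (map f ys)
  fx∉fxs [] [] = []
  fx∉fxs (py ∷ pys) (x≢y ∷ x∉ys) = (λ fx≡fy → x≢y (inj px py fx≡fy)) ∷ fx∉fxs pys x∉ys

length-filter-∩+∁ : ∀ {P : Pred A p} {Q : Pred A r} (P? : Decidable P) (Q? : Decidable Q) xs →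
  length (filter P? xs) ≡ length (filter (P? ∩? Q?) xs) +ℕ length (filter (P? ∩? ∁? Q?) xs)
length-filter-∩+∁ P? Q? [] = ≡.refl
length-filter-∩+∁ P? Q? (x ∷ xs) with P? x | Q? x
... | yes _ | yes _ = ≡.cong suc (length-filter-∩+∁ P? Q? xs)
... | yes _ | no _  = ≡.trans (≡.cong suc (length-filter-∩+∁ P? Q? xs)) (≡.sym (ℕ.+-suc _ _))
... | no _  | _     = length-filter-∩+∁ P? Q? xs

2∤odd-prime^k : ∀ {p} → Prime p → p ≢ 2 → ∀ k → 2 ∤ p ^ k
2∤odd-prime^k p-prime p≢2 zero 2∣1 with () ← ∣1⇒≡1 2∣1
2∤odd-prime^k p-prime p≢2 (suc k) 2∣p^[1+k] with euclidsLemma _ _ prime[2] 2∣p^[1+k]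
... | inj₂ 2∣p^k = 2∤odd-prime^k p-prime p≢2 k 2∣p^k
... | inj₁ 2∣p with prime⇒irreducible p-prime 2∣p
...   | inj₁ ()
...   | inj₂ 2≡p = p≢2 (≡.sym 2≡p)

module CommutativeRingProperties {c ℓ} (R : CommutativeRing c ℓ) where

  open CommutativeRing R
  open import Algebra.Properties.Ring ring using (-‿distribʳ-*)
  open import Algebra.Properties.AbelianGroup +-abelianGroup using (xyx⁻¹≈y)
  open import Algebra.Properties.Group +-group using (∙-cancelʳ)
  open import Relation.Binary.Reasoning.Setoid setoid
  open NaturalCoefficients commutativeSemiring using (solve; _:+_; _:*_; _:=_)

  [1+1]x≈x+x : ∀ x → (1# + 1#) * x ≈ x + x
  [1+1]x≈x+x x = trans (distribʳ x 1# 1#) (+-cong (*-identityˡ x) (*-identityˡ x))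

  [x+y][x-y]≈xx-yy : ∀ x y → (x + y) * (x - y) ≈ x * x - y * y
  [x+y][x-y]≈xx-yy x y = begin
    (x + y) * (x - y)                ≈⟨ solve 3 (λ x y w → (x :+ y) :* (x :+ w) := (x :* x :+ y :* w) :+ x :* (y :+ w)) refl x y (- y) ⟩
    (x * x + y * - y) + x * (y - y)  ≈⟨ +-cong (+-congˡ (sym (-‿distribʳ-* y y))) (trans (*-congˡ (-‿inverseʳ y)) (zeroʳ x)) ⟩
    (x * x - y * y) + 0#             ≈⟨ +-identityʳ _ ⟩
    x * x - y * y                    ∎

  module _ {a b c} (pythagorean : a * a + b * b ≈ c * c) where

    [c+a][c-a]≈bb : (c + a) * (c - a) ≈ b * b
    [c+a][c-a]≈bb = begin
      (c + a) * (c - a)      ≈⟨ [x+y][x-y]≈xx-yy c a ⟩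
      c * c - a * a          ≈⟨ +-congʳ (sym pythagorean) ⟩
      a * a + b * b - a * a  ≈⟨ xyx⁻¹≈y (a * a) (b * b) ⟩
      b * b                  ∎

    [c+a][2[c+b]]≈[c+a+b]² : (c + a) * ((1# + 1#) * (c + b)) ≈ (c + a + b) * (c + a + b)
    [c+a][2[c+b]]≈[c+a+b]² = ∙-cancelʳ (c * c) _ _ (begin
      (c + a) * ((1# + 1#) * (c + b)) + c * c          ≈⟨ +-cong (*-congˡ ([1+1]x≈x+x (c + b))) (sym pythagorean) ⟩
      (c + a) * ((c + b) + (c + b)) + (a * a + b * b)
        ≈⟨ solve 3 (λ a b c → (c :+ a) :* ((c :+ b) :+ (c :+ b)) :+ (a :* a :+ b :* b) := (c :+ a :+ b) :* (c :+ a :+ b) :+ c :* c) refl a b c ⟩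
      (c + a + b) * (c + a + b) + c * c                ∎)

module FiniteSetoidCounting {c ℓ} (S : Setoid c ℓ) {n : ℕ}
    (enum : Fin n → Setoid.Carrier S)
    (enum-surj : ∀ x → ∃ λ i → Setoid._≈_ S (enum i) x)
    (enum-inj : ∀ i j → Setoid._≈_ S (enum i) (enum j) → i ≡ j) where

  open Setoid S

  index : Carrier → Fin n
  index x = proj₁ (enum-surj x)

  enum-index : ∀ x → enum (index x) ≈ x
  enum-index x = proj₂ (enum-surj x)

  index-cong : ∀ {x y} → x ≈ y → index x ≡ index y
  index-cong {x} {y} x≈y = enum-inj _ _ (trans (enum-index x) (trans x≈y (sym (enum-index y))))

  index-injective : ∀ {x y} → index x ≡ index y → x ≈ y
  index-injective {x} {y} eq = trans (sym (enum-index x)) (trans (reflexive (≡.cong enum eq)) (enum-index y))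

  infix 4 _≺_ _≺?_
  _≺_ : Carrier → Carrier → Set
  x ≺ y = index x Fin.< index y

  _≺?_ : ∀ x y → Dec (x ≺ y)
  x ≺? y = index x Fin.<? index y

  ≺-resp : ∀ {x x′ y y′} → x ≈ x′ → y ≈ y′ → x ≺ y → x′ ≺ y′
  ≺-resp x≈x′ y≈y′ = ≡.subst₂ Fin._<_ (index-cong x≈x′) (index-cong y≈y′)

  ≺-asym : ∀ {x y} → x ≺ y → ¬ y ≺ x
  ≺-asym = Fin.<-asym

  count : {P : Pred Carrier p} → Decidable P → ℕ
  count P? = length (filter (P? ∘ enum) (allFin n))

  count-U : count U? ≡ n
  count-U = ≡.trans (≡.cong length (filter-all (U? ∘ enum) {xs = allFin n} (All.universal _ _)))
                    (length-tabulate {n = n} _)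

  count-∩+∁ : ∀ {P : Pred Carrier p} {Q : Pred Carrier r} (P? : Decidable P) (Q? : Decidable Q) →
              count P? ≡ count (P? ∩? Q?) +ℕ count (P? ∩? ∁? Q?)
  count-∩+∁ P? Q? = length-filter-∩+∁ (P? ∘ enum) (Q? ∘ enum) (allFin n)

  module _ {P : Pred Carrier p} {Q : Pred Carrier r} (P? : Decidable P) (Q? : Decidable Q)
      (Q-resp : Q Respects _≈_) (f : Carrier → Carrier) (f-P⇒Q : ∀ {x} → P x → Q (f x))
      (f-injective : ∀ {x y} → P x → P y → f x ≈ f y → x ≈ y) where

    private
      Ps = filter (P? ∘ enum) (allFin n)
      Qs = filter (Q? ∘ enum) (allFin n)
      f̂ = index ∘ f ∘ enum
      image = map f̂ Ps

      Ps⇒P : ∀ {i} → i ∈ Ps → P (enum i)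
      Ps⇒P i∈Ps = proj₂ (∈-filter⁻ (P? ∘ enum) {xs = allFin n} i∈Ps)

      Q⇒Qs : ∀ {x} → Q x → index x ∈ Qs
      Q⇒Qs {x} Qx = ∈-filter⁺ (Q? ∘ enum) (∈-allFin _) (Q-resp (sym (enum-index x)) Qx)

      image! : Unique image
      image! = map⁺-injectiveOn (λ Pi Pj eq → enum-inj _ _ (f-injective Pi Pj (index-injective eq)))
                 (All.all-filter (P? ∘ enum) (allFin n))
                 (Unique.filter⁺ (P? ∘ enum) (Unique.allFin⁺ n))

      image⊆Qs : image ⊆ Qs
      image⊆Qs j∈image with ∈-map⁻ f̂ j∈image
      ... | i , i∈Ps , ≡.refl = Q⇒Qs (f-P⇒Q (Ps⇒P i∈Ps))

    count-injection : count P? ≤ count Q?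
    count-injection = ≡.subst (_≤ length Qs) (length-map f̂ Ps) (Unique∧⊆⇒length≤ Fin._≟_ image! image⊆Qs)

    count-injection-missing : ∀ m → Q m → (∀ {x} → P x → ¬ f x ≈ m) → count P? < count Q?
    count-injection-missing m Qm f≉m =
      ≡.subst (λ k → suc k ≤ length Qs) (length-map f̂ Ps)
        (Unique∧⊆⇒length≤ Fin._≟_ (All.tabulate m∉image ∷ image!) m∷image⊆Qs)
      where
      m∉image : ∀ {j} → j ∈ image → index m ≢ j
      m∉image j∈image eq with ∈-map⁻ f̂ j∈image
      ... | i , i∈Ps , ≡.refl = f≉m (Ps⇒P i∈Ps) (sym (index-injective eq))
      m∷image⊆Qs : index m ∷ image ⊆ Qs
      m∷image⊆Qs (here ≡.refl)   = Q⇒Qs Qm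
      m∷image⊆Qs (there j∈image) = image⊆Qs j∈image

  -- Of the two elements x, g x of each orbit, exactly one comes first in the enumeration.
  module _ {P : Pred Carrier p} (P? : Decidable P) (P-resp : P Respects _≈_)
      (g : Carrier → Carrier) (g-cong : ∀ {x y} → x ≈ y → g x ≈ g y)
      (g-involutive : ∀ x → g (g x) ≈ x) (g-P : ∀ {x} → P x → P (g x))
      (g-fixedPointFree : ∀ {x} → P x → ¬ g x ≈ x) where

    private
      g-injective : ∀ {x y} → g x ≈ g y → x ≈ y
      g-injective {x} {y} gx≈gy = trans (sym (g-involutive x)) (trans (g-cong gx≈gy) (g-involutive y))

      first⇒second : ∀ {x} → P x × x ≺ g x → P (g x) × ¬ g x ≺ g (g x)
      first⇒second {x} (Px , x≺gx) = g-P Px , λ gx≺ggx → ≺-asym x≺gx (≺-resp refl (g-involutive x) gx≺ggx)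

      second⇒first : ∀ {x} → P x × ¬ x ≺ g x → P (g x) × g x ≺ g (g x)
      second⇒first {x} (Px , x⊀gx) with Fin.<-cmp (index x) (index (g x))
      ... | tri< x≺gx _ _ = ⊥-elim (x⊀gx x≺gx)
      ... | tri≈ _ eq _   = ⊥-elim (g-fixedPointFree Px (sym (index-injective eq)))
      ... | tri> _ _ gx≺x = g-P Px , ≺-resp refl (sym (g-involutive x)) gx≺x

    count-involution : count P? ≡ count (P? ∩? λ x → x ≺? g x) +ℕ count (P? ∩? λ x → x ≺? g x)
    count-involution = ≡.trans (count-∩+∁ P? (λ x → x ≺? g x)) (≡.cong (first +ℕ_) (ℕ.≤-antisym second≤first first≤second))
      where
      first  = count (P? ∩? λ x → x ≺? g x)
      second = count (P? ∩? ∁? λ x → x ≺? g x)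
      first≤second : first ≤ second
      first≤second = count-injection (P? ∩? λ x → x ≺? g x) (P? ∩? ∁? λ x → x ≺? g x)
        (λ x≈y (Px , x⊀gx) → P-resp x≈y Px , λ y≺gy → x⊀gx (≺-resp (sym x≈y) (g-cong (sym x≈y)) y≺gy))
        g first⇒second (λ _ _ → g-injective)
      second≤first : second ≤ first
      second≤first = count-injection (P? ∩? ∁? λ x → x ≺? g x) (P? ∩? λ x → x ≺? g x)
        (λ x≈y (Px , x≺gx) → P-resp x≈y Px , ≺-resp x≈y (g-cong x≈y) x≺gx)
        g second⇒first (λ _ _ → g-injective)

module FiniteFieldProperties {q : ℕ} (F : FiniteField q) where

  open FiniteField F
  open FiniteSetoidCounting setoid enum enum-surj enum-inj
  open CommutativeRingProperties commRing using ([1+1]x≈x+x; [x+y][x-y]≈xx-yy)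
  open import Algebra.Properties.Group +-group
    using (x∙y⁻¹≈ε⇒x≈y; inverseˡ-unique; ⁻¹-involutive; ⁻¹-injective; ε⁻¹≈ε; identityʳ-unique)
  open import Relation.Binary.Reasoning.Setoid setoid
  open NaturalCoefficients commutativeSemiring using (solve; _:*_; _:=_)

  Nonzero : Pred Carrier 0ℓ
  Nonzero x = ¬ x ≈ 0#

  nonzero? : Decidable Nonzero
  nonzero? x = ¬? (x ≟ 0#)

  Nonzero-resp : Nonzero Respects _≈_
  Nonzero-resp x≈y x≉0 y≈0 = x≉0 (trans x≈y y≈0)

  -‿nonzero : ∀ {x} → Nonzero x → Nonzero (- x)
  -‿nonzero x≉0 -x≈0 = x≉0 (⁻¹-injective (trans -x≈0 (sym ε⁻¹≈ε)))

  *-nonzeroˡ : ∀ {x y} → Nonzero (x * y) → Nonzero x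
  *-nonzeroˡ {y = y} xy≉0 x≈0 = xy≉0 (trans (*-congʳ x≈0) (zeroˡ y))

  *-nonzeroʳ : ∀ {x y} → Nonzero (x * y) → Nonzero y
  *-nonzeroʳ {x} xy≉0 y≈0 = xy≉0 (trans (*-congˡ y≈0) (zeroʳ x))

  *-cancelˡ-nonzero : AlmostLeftCancellative _≈_ 0# _*_
  *-cancelˡ-nonzero x y z x≉0 xy≈xz with inverse x x≉0
  ... | x⁻¹ , xx⁻¹≈1 = begin
    y              ≈⟨ trans (*-congʳ xx⁻¹≈1) (*-identityˡ y) ⟨
    (x * x⁻¹) * y  ≈⟨ solve 3 (λ x x⁻¹ y → (x :* x⁻¹) :* y := x⁻¹ :* (x :* y)) refl x x⁻¹ y ⟩
    x⁻¹ * (x * y)  ≈⟨ *-congˡ xy≈xz ⟩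
    x⁻¹ * (x * z)  ≈⟨ solve 3 (λ x x⁻¹ z → x⁻¹ :* (x :* z) := (x :* x⁻¹) :* z) refl x x⁻¹ z ⟩
    (x * x⁻¹) * z  ≈⟨ trans (*-congʳ xx⁻¹≈1) (*-identityˡ z) ⟩
    z              ∎

  cancellativeCommutativeSemiring : CancellativeCommutativeSemiring 0ℓ 0ℓ
  cancellativeCommutativeSemiring = record
    { isCancellativeCommutativeSemiring = record
      { isCommutativeSemiring = isCommutativeSemiring
      ; *-cancelˡ-nonZero     = *-cancelˡ-nonzero
      }
    }

  open CancellativeCommutativeSemiringProperties cancellativeCommutativeSemiring
    using (xy≈0⇒x≈0∨y≈0; x≉0∧y≉0⇒xy≉0)

  *-nonzero : ∀ {x y} → Nonzero x → Nonzero y → Nonzero (x * y)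
  *-nonzero = x≉0∧y≉0⇒xy≉0 _≟_

  nonzero-factors : ∀ {x y z} → x * y ≈ z * z → Nonzero z → Nonzero x × Nonzero y
  nonzero-factors xy≈zz z≉0 = let xy≉0 = Nonzero-resp (sym xy≈zz) (*-nonzero z≉0 z≉0) in
    *-nonzeroˡ xy≉0 , *-nonzeroʳ xy≉0

  xx≈yy⇒x≈-y⊎x≈y : ∀ {x y} → x * x ≈ y * y → x ≈ - y ⊎ x ≈ y
  xx≈yy⇒x≈-y⊎x≈y {x} {y} xx≈yy =
    Sum.map (inverseˡ-unique x y) (x∙y⁻¹≈ε⇒x≈y x y) (xy≈0⇒x≈0∨y≈0 _≟_ [x+y][x-y]≈0)
    where
    [x+y][x-y]≈0 : (x + y) * (x - y) ≈ 0#
    [x+y][x-y]≈0 = trans ([x+y][x-y]≈xx-yy x y) (trans (+-congʳ xx≈yy) (-‿inverseʳ (y * y)))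

  -- If 2 = 0 then x ↦ x + 1 is a fixed-point-free involution, so q would be even.
  2∤q⇒2≉0 : 2 ∤ q → Nonzero 2#
  2∤q⇒2≉0 2∤q 2≈0 = 2∤q (divides half (≡.trans (≡.sym count-U) (≡.trans q≡half+half half+half≡half*2)))
    where
    x+1+1≈x : ∀ x → x + 1# + 1# ≈ x
    x+1+1≈x x = trans (+-assoc x 1# 1#) (trans (+-congˡ 2≈0) (+-identityʳ x))
    x+1≉x : ∀ x → ¬ x + 1# ≈ x
    x+1≉x x x+1≈x = 0≉1 (sym (identityʳ-unique x 1# x+1≈x))
    half = count (U? ∩? λ x → x ≺? x + 1#)
    q≡half+half = count-involution U? (λ _ _ → tt) (_+ 1#) +-congʳ x+1+1≈x (λ _ → tt) (λ _ → x+1≉x _)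
    half+half≡half*2 : half +ℕ half ≡ half *ℕ 2
    half+half≡half*2 = ≡.trans (≡.cong (half +ℕ_) (≡.sym (ℕ.+-identityʳ half))) (ℕ.*-comm 2 half)

  -x≉x : Nonzero 2# → ∀ {x} → Nonzero x → ¬ - x ≈ x
  -x≉x 2≉0 {x} x≉0 -x≈x = *-nonzero 2≉0 x≉0 (begin
    2# * x  ≈⟨ [1+1]x≈x+x x ⟩
    x + x   ≈⟨ +-congˡ -x≈x ⟨
    x - x   ≈⟨ -‿inverseʳ x ⟩
    0#      ∎)

  IsSquare-resp : IsSquare Respects _≈_
  IsSquare-resp x≈y (u , uu≈x) = u , trans uu≈x x≈y

  IsSquare-* : ∀ {x y} → IsSquare x → IsSquare y → IsSquare (x * y)
  IsSquare-* (u , uu≈x) (v , vv≈y) =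
    u * v , trans (solve 2 (λ u v → (u :* v) :* (u :* v) := (u :* u) :* (v :* v)) refl u v) (*-cong uu≈x vv≈y)

  IsSquare-x[xz] : ∀ {x z} → IsSquare z → IsSquare (x * (x * z))
  IsSquare-x[xz] {x} {z} □z = IsSquare-resp (*-assoc x x z) (IsSquare-* (x , refl) □z)

  IsSquare-*-cancelˡ : ∀ {x y} → Nonzero x → IsSquare x → IsSquare (x * y) → IsSquare y
  IsSquare-*-cancelˡ {x} {y} x≉0 (u , uu≈x) (w , ww≈xy) with inverse u (*-nonzeroˡ (Nonzero-resp (sym uu≈x) x≉0))
  ... | u⁻¹ , uu⁻¹≈1 = w * u⁻¹ , (begin
    (w * u⁻¹) * (w * u⁻¹)        ≈⟨ solve 2 (λ w u⁻¹ → (w :* u⁻¹) :* (w :* u⁻¹) := (w :* w) :* (u⁻¹ :* u⁻¹)) refl w u⁻¹ ⟩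
    (w * w) * (u⁻¹ * u⁻¹)        ≈⟨ *-congʳ (trans ww≈xy (*-congʳ (sym uu≈x))) ⟩
    ((u * u) * y) * (u⁻¹ * u⁻¹)  ≈⟨ solve 3 (λ u u⁻¹ y → ((u :* u) :* y) :* (u⁻¹ :* u⁻¹) := ((u :* u⁻¹) :* (u :* u⁻¹)) :* y) refl u u⁻¹ y ⟩
    ((u * u⁻¹) * (u * u⁻¹)) * y  ≈⟨ *-congʳ (trans (*-cong uu⁻¹≈1 uu⁻¹≈1) (*-identityˡ 1#)) ⟩
    1# * y                       ≈⟨ *-identityˡ y ⟩
    y                            ∎)

  ¬IsSquare⇒nonzero : ∀ {x} → ¬ IsSquare x → Nonzero x
  ¬IsSquare⇒nonzero ¬□x x≈0 = ¬□x (0# , trans (zeroˡ 0#) (sym x≈0))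

  nonzeroSquare? : Decidable (Nonzero ∩ IsSquare)
  nonzeroSquare? = nonzero? ∩? isSquare?

  nonsquare? : Decidable (Nonzero ∩ ∁ IsSquare)
  nonsquare? = nonzero? ∩? ∁? isSquare?

  nonzeroSquare-resp : (Nonzero ∩ IsSquare) Respects _≈_
  nonzeroSquare-resp x≈y (x≉0 , □x) = Nonzero-resp x≈y x≉0 , IsSquare-resp x≈y □x

  nonsquare-resp : (Nonzero ∩ ∁ IsSquare) Respects _≈_
  nonsquare-resp x≈y (x≉0 , ¬□x) = Nonzero-resp x≈y x≉0 , ¬□x ∘ IsSquare-resp (sym x≈y)

  count-nonzero≤2*count-squares : Nonzero 2# → count nonzero? ≤ count nonzeroSquare? +ℕ count nonzeroSquare?
  count-nonzero≤2*count-squares 2≉0 =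
    ℕ.≤-trans (ℕ.≤-reflexive nonzero≡first+first) (ℕ.+-mono-≤ first≤squares first≤squares)
    where
    nonzero≡first+first = count-involution nonzero? Nonzero-resp -_ -‿cong ⁻¹-involutive -‿nonzero (-x≉x 2≉0)
    squaring-injective : ∀ {x y} → x ≺ - x → y ≺ - y → x * x ≈ y * y → x ≈ y
    squaring-injective {x} {y} x≺-x y≺-y xx≈yy with xx≈yy⇒x≈-y⊎x≈y xx≈yy
    ... | inj₂ x≈y  = x≈y
    ... | inj₁ x≈-y = contradiction (≺-resp x≈-y (trans (-‿cong x≈-y) (⁻¹-involutive y)) x≺-x) (≺-asym y≺-y)
    first≤squares = count-injection (nonzero? ∩? λ x → x ≺? - x) nonzeroSquare? nonzeroSquare-resp
      (λ x → x * x) (λ {x} (x≉0 , _) → *-nonzero x≉0 x≉0 , (x , refl))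
      (λ (_ , x≺-x) (_ , y≺-y) → squaring-injective x≺-x y≺-y)

  ¬IsSquare*¬IsSquare⇒IsSquare : Nonzero 2# → ∀ {x y} → ¬ IsSquare x → ¬ IsSquare y → IsSquare (x * y)
  ¬IsSquare*¬IsSquare⇒IsSquare 2≉0 {x} {y} ¬□x ¬□y = decidable-stable (isSquare? (x * y)) λ ¬□xy →
    ℕ.<⇒≱ (squares<nonsquares ¬□xy) (ℕ.+-cancelˡ-≤ squares nonsquares squares
      (≡.subst (_≤ squares +ℕ squares) (count-∩+∁ nonzero? isSquare?) (count-nonzero≤2*count-squares 2≉0)))
    where
    squares = count nonzeroSquare?
    nonsquares = count nonsquare?
    x≉0 = ¬IsSquare⇒nonzero ¬□x
    squares<nonsquares : ¬ IsSquare (x * y) → squares < nonsquares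
    squares<nonsquares ¬□xy = count-injection-missing nonzeroSquare? nonsquare? nonsquare-resp
      (x *_)
      (λ {z} (z≉0 , □z) → *-nonzero x≉0 z≉0 , λ □xz → ¬□x (IsSquare-*-cancelˡ z≉0 □z (IsSquare-resp (*-comm x z) □xz)))
      (λ _ _ → *-cancelˡ-nonzero _ _ _ x≉0)
      y (¬IsSquare⇒nonzero ¬□y , ¬□y)
      (λ (_ , □z) xz≈y → ¬□xy (IsSquare-resp (*-congˡ xz≈y) (IsSquare-x[xz] □z)))

  legendre-square : ∀ {x} → Nonzero x → IsSquare x → legendre x ≡ 1ℤ
  legendre-square {x} x≉0 □x with x ≟ 0#
  ... | yes x≈0 = contradiction x≈0 x≉0
  ... | no _ with isSquare? x
  ... | yes _   = ≡.refl
  ... | no ¬□x  = contradiction □x ¬□x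

  legendre-nonsquare : ∀ {x} → ¬ IsSquare x → legendre x ≡ -1ℤ
  legendre-nonsquare {x} ¬□x with x ≟ 0#
  ... | yes x≈0 = contradiction x≈0 (¬IsSquare⇒nonzero ¬□x)
  ... | no _ with isSquare? x
  ... | yes □x  = contradiction □x ¬□x
  ... | no _    = ≡.refl

  legendre-nonzero : ∀ {x} → Nonzero x → legendre x ≢ 0ℤ
  legendre-nonzero {x} x≉0 with x ≟ 0#
  ... | yes x≈0 = contradiction x≈0 x≉0
  ... | no _ with isSquare? x
  ... | yes _   = λ ()
  ... | no _    = λ ()

  legendre-≡ : ∀ {x y} → Nonzero x → Nonzero y → IsSquare (x * y) → legendre x ≡ legendre y
  legendre-≡ {x} {y} x≉0 y≉0 □xy with isSquare? x | isSquare? y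
  ... | yes □x | yes □y = ≡.trans (legendre-square x≉0 □x) (≡.sym (legendre-square y≉0 □y))
  ... | yes □x | no ¬□y = contradiction (IsSquare-*-cancelˡ x≉0 □x □xy) ¬□y
  ... | no ¬□x | yes □y = contradiction (IsSquare-*-cancelˡ y≉0 □y (IsSquare-resp (*-comm x y) □xy)) ¬□x
  ... | no ¬□x | no ¬□y = ≡.trans (legendre-nonsquare ¬□x) (≡.sym (legendre-nonsquare ¬□y))

  legendre-* : Nonzero 2# → ∀ {x y} → Nonzero x → Nonzero y → legendre (x * y) ≡ legendre x *ℤ legendre y
  legendre-* 2≉0 {x} {y} x≉0 y≉0 with isSquare? x | isSquare? y
  ... | yes □x | yes □y = ≡.trans (legendre-square (*-nonzero x≉0 y≉0) (IsSquare-* □x □y))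
                            (≡.sym (≡.cong₂ _*ℤ_ (legendre-square x≉0 □x) (legendre-square y≉0 □y)))
  ... | yes □x | no ¬□y = ≡.trans (legendre-nonsquare (¬□y ∘ IsSquare-*-cancelˡ x≉0 □x))
                            (≡.sym (≡.cong₂ _*ℤ_ (legendre-square x≉0 □x) (legendre-nonsquare ¬□y)))
  ... | no ¬□x | yes □y = ≡.trans (legendre-nonsquare (¬□x ∘ IsSquare-*-cancelˡ y≉0 □y ∘ IsSquare-resp (*-comm x y)))
                            (≡.sym (≡.cong₂ _*ℤ_ (legendre-nonsquare ¬□x) (legendre-square y≉0 □y)))
  ... | no ¬□x | no ¬□y = ≡.trans (legendre-square (*-nonzero x≉0 y≉0) (¬IsSquare*¬IsSquare⇒IsSquare 2≉0 ¬□x ¬□y))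
                            (≡.sym (≡.cong₂ _*ℤ_ (legendre-nonsquare ¬□x) (legendre-nonsquare ¬□y)))

lemma6p1 : ∀ (p k q : ℕ) → Prime p → p ≢ 2 → 1 ≤ k → q ≡ p ^ k →
    (F : FiniteField q) → let open FiniteField F in
    ∀ (a b c : Carrier) → ¬ (a * b ≈ 0#) → (a * a) + (b * b) ≈ c * c →
      (legendre (c + a) ≡ legendre 2# *ℤ legendre (c + b))
      × (legendre (c + a) ≢ 0ℤ)
      × (legendre (c + a) ≡ legendre (c - a))
      × (legendre (c + b) ≡ legendre (c - b))
lemma6p1 p k q p-prime p≢2 _ ≡.refl F a b c ab≉0 pythagorean =
    ≡.trans (legendre-≡ c+a≉0 (*-nonzero 2≉0 c+b≉0) (c + a + b , sym ([c+a][2[c+b]]≈[c+a+b]² pythagorean)))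
            (legendre-* 2≉0 2≉0 c+b≉0)
  , legendre-nonzero c+a≉0
  , legendre-≡ c+a≉0 c-a≉0 (b , sym c²-a²≈b²)
  , legendre-≡ c+b≉0 c-b≉0 (a , sym c²-b²≈a²)
  where
  open FiniteField F
  open FiniteFieldProperties F
  open CommutativeRingProperties commRing using ([c+a][c-a]≈bb; [c+a][2[c+b]]≈[c+a+b]²)
  2≉0 = 2∤q⇒2≉0 (2∤odd-prime^k p-prime p≢2 k)
  c²-a²≈b² = [c+a][c-a]≈bb pythagorean
  c²-b²≈a² = [c+a][c-a]≈bb (trans (+-comm (b * b) (a * a)) pythagorean)
  c+a≉0 = proj₁ (nonzero-factors c²-a²≈b² (*-nonzeroʳ ab≉0))
  c-a≉0 = proj₂ (nonzero-factors c²-a²≈b² (*-nonzeroʳ ab≉0))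
  c+b≉0 = proj₁ (nonzero-factors c²-b²≈a² (*-nonzeroˡ ab≉0))
  c-b≉0 = proj₂ (nonzero-factors c²-b²≈a² (*-nonzeroˡ ab≉0))
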